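{- Let $A$ be a string over $\{0,1,2\}$ such that no iterate $A_n$ splits as a concatenation of neutrinos. Then in the particle decompositions of the iterates $A_n$ (as defined in the context), the proportion of particles that are bosons or neutrinos tends to $0$ as $n\to\infty$, and for each fermion the proportion of particles equal to that fermion tends to a limit; these limits are approximately (to two decimal places): $E$: $18.50\%$, $M$: $13.97\%$, $D$: $13.97\%$, $B$: $13.97\%$, $U$: $10.54\%$, $S$: $10.54\%$, $T$: $10.54\%$, $C$: $7.96\%$.
   Context: All strings are finite sequences of digits from $\{0,1,2\}$. A run is a maximal block of consecutive equal digits. The base-3 look-and-say operation sends a string $A$, written as its runs $r_1\cdots r_k$ with $r_i$ consisting of $n_i$ copies of the digit $d_i$, to the string $A_1$ obtained by replacing each $r_i$ by the base-3 representation of $n_i$ (no leading zeros) followed by $d_i$, and concatenating; $A_0=A$, $A_{n+1}=(A_n)_1$. A string $A$ splits as $P_1.\cdots.P_r$ if $A=P_1\cdots P_r$ and $A_n=(P_1)_n\cdots(P_r)_n$ for all $n\ge 0$. The fermions are $E=10$, $M=1110$, $U=110$, $D=2110$, $S=122110$, $C=11222110$, $B=22110$, $T=222110$; the bosons are $211, 1221, 112211, 12221, 2, 12, 1112, 112, 2112, 122112, 11222112, 22112, 222112$; the neutrinos are $22, 11110, 11112$; these 24 strings are the common particles. Each common particle $P$ has image $P_1$ splitting into common particles as follows: $E\to M$; $M\to E.U$; $U\to D$; $D\to S$; $S\to C$; $C\to D.B$; $B\to T$; $T\to E.B$; $12\to 1112$; $1112\to E.112$; $112\to 2112$; $2112\to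 122112$; $122112\to 11222112$; $11222112\to D.22112$; $22112\to 222112$; $222112\to E.22112$; $211\to 1221$; $1221\to 112211$; $112211\to 2.12221$; $12221\to M.211$; $2\to 12$; each neutrino maps to itself. Particle decompositions: fix $N$ such that $A_N$ splits as a concatenation $P_1.\cdots.P_r$ of common particles; the decomposition of $A_N$ is the list $(P_1,\dots,P_r)$, and for $n\ge N$ the decomposition of $A_{n+1}$ is obtained from that of $A_n$ by replacing each particle with the list of particles of its image given above. A neutrino-concatenation means a splitting $P_1.\cdots.P_r$ ($r\ge0$) with every $P_i$ a neutrino. -}

module Defs where

open import Data.Nat using (ℕ; zero; suc; _≡ᵇ_)
open import Data.Nat.DivMod using (_/_; _mod_)
open import Data.Fin using (Fin; zero; suc; _≟_)
open import Data.Bool using (Bool; true; false; if_then_else_)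
open import Data.List using (List; []; _∷_; _++_; [_]; concat; map; concatMap; length; filter)
open import Data.Product using (Σ; ∃; _×_; _,_)
open import Data.List.Relation.Unary.All using (All)
open import Relation.Nullary using (does)
open import Relation.Binary.PropositionalEquality using (_≡_)
open import Data.Rational using (ℚ; 0ℚ)
import Data.Rational as Q
open import Data.Integer using (+_)

Digit : Set
Digit = Fin 3

Str : Set
Str = List Digit

d0 d1 d2 : Digit
d0 = zero
d1 = suc zero
d2 = suc (suc zero)

-- base-3 representation (most significant digit first, no leading zeros;
-- the empty list for 0). The first argument is fuel (fuel = n suffices).
base3-aux : ℕ → ℕ → Str
base3-aux zero    _ = []
base3-aux (suc f) zero = []
base3-aux (suc f) (suc n) = base3-aux f (suc n / 3) ++ [ suc n mod 3 ]

base3 : ℕ → Str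
base3 n = base3-aux n n

-- look-and-say: 'go d k xs' means: the current run is k copies of d,
-- followed by the remaining string xs.
las-go : Digit → ℕ → Str → Str
las-go d k [] = base3 k ++ [ d ]
las-go d k (x ∷ xs) =
  if does (x ≟ d) then las-go d (suc k) xs
  else (base3 k ++ [ d ]) ++ las-go x 1 xs

las : Str → Str
las [] = []
las (x ∷ xs) = las-go x 1 xs

iter : ℕ → Str → Str
iter zero    A = A
iter (suc n) A = las (iter n A)

Splits : Str → List Str → Set
Splits A Ps = (n : ℕ) → iter n A ≡ concat (map (iter n) Ps)

data Fermion : Set where
  E M U D S C B T : Fermion

data Particle : Set where
  fer : Fermion → Particle
  b211 b1221 b112211 b12221 b2 b12 b1112 b112 b2112 b122112 b11222112 b22112 b222112 : Particle
  n22 n11110 n11112 : Particle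

fstr : Fermion → Str
fstr E = d1 ∷ d0 ∷ []
fstr M = d1 ∷ d1 ∷ d1 ∷ d0 ∷ []
fstr U = d1 ∷ d1 ∷ d0 ∷ []
fstr D = d2 ∷ d1 ∷ d1 ∷ d0 ∷ []
fstr S = d1 ∷ d2 ∷ d2 ∷ d1 ∷ d1 ∷ d0 ∷ []
fstr C = d1 ∷ d1 ∷ d2 ∷ d2 ∷ d2 ∷ d1 ∷ d1 ∷ d0 ∷ []
fstr B = d2 ∷ d2 ∷ d1 ∷ d1 ∷ d0 ∷ []
fstr T = d2 ∷ d2 ∷ d2 ∷ d1 ∷ d1 ∷ d0 ∷ []

str : Particle → Str
str (fer f)   = fstr f
str b211      = d2 ∷ d1 ∷ d1 ∷ []
str b1221     = d1 ∷ d2 ∷ d2 ∷ d1 ∷ []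
str b112211   = d1 ∷ d1 ∷ d2 ∷ d2 ∷ d1 ∷ d1 ∷ []
str b12221    = d1 ∷ d2 ∷ d2 ∷ d2 ∷ d1 ∷ []
str b2        = d2 ∷ []
str b12       = d1 ∷ d2 ∷ []
str b1112     = d1 ∷ d1 ∷ d1 ∷ d2 ∷ []
str b112      = d1 ∷ d1 ∷ d2 ∷ []
str b2112     = d2 ∷ d1 ∷ d1 ∷ d2 ∷ []
str b122112   = d1 ∷ d2 ∷ d2 ∷ d1 ∷ d1 ∷ d2 ∷ []
str b11222112 = d1 ∷ d1 ∷ d2 ∷ d2 ∷ d2 ∷ d1 ∷ d1 ∷ d2 ∷ []
str b22112    = d2 ∷ d2 ∷ d1 ∷ d1 ∷ d2 ∷ []
str b222112   = d2 ∷ d2 ∷ d2 ∷ d1 ∷ d1 ∷ d2 ∷ []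
str n22       = d2 ∷ d2 ∷ []
str n11110    = d1 ∷ d1 ∷ d1 ∷ d1 ∷ d0 ∷ []
str n11112    = d1 ∷ d1 ∷ d1 ∷ d1 ∷ d2 ∷ []

data IsNeutrino : Particle → Set where
  ν22    : IsNeutrino n22
  ν11110 : IsNeutrino n11110
  ν11112 : IsNeutrino n11112

image : Particle → List Particle
image (fer E) = fer M ∷ []
image (fer M) = fer E ∷ fer U ∷ []
image (fer U) = fer D ∷ []
image (fer D) = fer S ∷ []
image (fer S) = fer C ∷ []
image (fer C) = fer D ∷ fer B ∷ []
image (fer B) = fer T ∷ []
image (fer T) = fer E ∷ fer B ∷ []
image b12       = b1112 ∷ []
image b1112     = fer E ∷ b112 ∷ []
image b112      = b2112 ∷ []
image b2112     = b122112 ∷ []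
image b122112   = b11222112 ∷ []
image b11222112 = fer D ∷ b22112 ∷ []
image b22112    = b222112 ∷ []
image b222112   = fer E ∷ b22112 ∷ []
image b211      = b1221 ∷ []
image b1221     = b112211 ∷ []
image b112211   = b2 ∷ b12221 ∷ []
image b12221    = fer M ∷ b211 ∷ []
image b2        = b12 ∷ []
image n22       = n22 ∷ []
image n11110    = n11110 ∷ []
image n11112    = n11112 ∷ []

-- decomposition of A_{N+k}, given the decomposition ps of A_N
decomp : ℕ → List Particle → List Particle
decomp zero    ps = ps
decomp (suc k) ps = concatMap image (decomp k ps)

fIndex : Fermion → ℕ
fIndex E = 0
fIndex M = 1
fIndex U = 2
fIndex D = 3
fIndex S = 4
fIndex C = 5
fIndex B = 6
fIndex T = 7

isFermion : Particle → Bool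
isFermion (fer _) = true
isFermion _       = false

isNonFermion : Particle → Bool
isNonFermion p = if isFermion p then false else true

isThe : Fermion → Particle → Bool
isThe f (fer g) = fIndex f ≡ᵇ fIndex g
isThe f _       = false

countB : (Particle → Bool) → List Particle → ℕ
countB P []       = 0
countB P (x ∷ xs) = if P x then suc (countB P xs) else countB P xs

-- c / l as a rational (0 if l = 0)
ratio : ℕ → ℕ → ℚ
ratio c zero    = 0ℚ
ratio c (suc l) = (+ c) Q./ suc l

proportion : (Particle → Bool) → List Particle → ℚ
proportion P ps = ratio (countB P ps) (length ps)

-- u converges (to some real number): u is Cauchy
Converges : (ℕ → ℚ) → Set
Converges u = (ε : ℚ) → Q.Positive ε →
  ∃ λ N → (m n : ℕ) → N Data.Nat.≤ m → N Data.Nat.≤ n → Q.∣ u m Q.- u n ∣ Q.< ε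

TendsToZero : (ℕ → ℚ) → Set
TendsToZero u = (ε : ℚ) → Q.Positive ε →
  ∃ λ N → (n : ℕ) → N Data.Nat.≤ n → Q.∣ u n ∣ Q.< ε

-- the limit of u (assumed to exist) lies in the closed interval [lo, hi]
LimitIn : (ℕ → ℚ) → ℚ → ℚ → Set
LimitIn u lo hi = (ε : ℚ) → Q.Positive ε →
  ∃ λ N → (n : ℕ) → N Data.Nat.≤ n → (lo Q.- ε Q.< u n) × (u n Q.< hi Q.+ ε)

-- stated limiting proportions, in hundredths of a percent
pct : Fermion → ℕ
pct E = 1850
pct M = 1397
pct D = 1397
pct B = 1397
pct U = 1054
pct S = 1054
pct T = 1054
pct C = 796

-- "x% to two decimal places": the value lies in [x% - 0.005%, x% + 0.005%]
lowerBound upperBound : Fermion → ℚ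
lowerBound f = (+ (10 Data.Nat.* pct f Data.Nat.∸ 5)) Q./ 100000
upperBound f = (+ (10 Data.Nat.* pct f Data.Nat.+ 5)) Q./ 100000

{-# OPTIONS --safe #-}

-- Fermions only produce fermions, every particle other than a neutrino yields a fermion within
-- 4 steps, and the number of fermions at least doubles every 14 steps. Non-fermions grow at most
-- linearly, since new ones are only emitted by the bosons of the cycle
-- 211 → 1221 → 112211 → 2.12221 → M.211, whose number never increases; hence the proportion of
-- non-fermions tends to 0.
-- The numbers of the eight fermions evolve by a nonnegative matrix M whose 14th power has all
-- entries between 1 and 17. So every column of M^(k+14) is M^k·1 (the sum of the columns of M^k)
-- plus at most 16 times as much again, and an interval containing the proportion of a fermion in
-- every column of M^k shrinks by the factor 16/17 every 14 steps. This makes the proportions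
-- Cauchy, and an explicit interval after 147 steps locates the limits.

module Submission where

open import Defs
open import Data.Nat using (ℕ)
open import Data.List using (List; map)
open import Data.List.Relation.Unary.All using (All)
open import Data.Product using (Σ; ∃; _×_)
open import Relation.Nullary using (¬_)
open import Relation.Binary.PropositionalEquality using (_≡_)

open import Data.Nat
  using (zero; suc; pred; _+_; _*_; _∸_; _^_; _≤_; _<_; _≤′_; ≤′-refl; ≤′-step; z≤n; s≤s; _≤?_; _≟_;
         NonZero; >-nonZero)
open import Data.Nat.Properties
open import Data.Nat.DivMod using (_/_; _%_; m≡m%n+[m/n]*n; m%n<n; m/n*n≤m; m*n/n≡m; /-monoˡ-≤)
open import Data.Nat.Tactic.RingSolver using (solve-∀)
open import Algebra.Properties.CommutativeSemigroup +-commutativeSemigroup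
  using () renaming (interchange to +-interchange)
open import Data.Bool using (Bool; true; false)
open import Data.Fin using (Fin; zero; suc; #_)
import Data.Fin.Properties as Fin
open import Data.Vec using (Vec; []; _∷_)
import Data.Vec as Vec
open import Data.Vec.Properties using (lookup-map; lookup-zipWith; lookup-replicate; ≡-dec)
open import Data.Vec.Relation.Binary.Pointwise.Inductive using (Pointwise-≡⇒≡; []; _∷_)
open import Data.List using ([]; _∷_; _++_; [_]; length; concatMap)
open import Data.List.Properties using (length-++; concatMap-++)
open import Data.List.Relation.Unary.All using ([]; _∷_)
import Data.List.Relation.Unary.All as All
open import Data.List.Relation.Unary.All.Properties using (++⁺)
open import Data.Product using (∃₂; _,_; proj₁; proj₂; uncurry)
open import Data.Sum using (_⊎_; inj₁; inj₂)
open import Data.Empty using (⊥-elim)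
open import Function using (_∘_)
open import Relation.Nullary using (Dec; yes; no; map′; contradiction)
open import Relation.Nullary.Decidable using (from-yes; _⊎-dec_; _×-dec_)
open import Relation.Unary using (Decidable)
open import Relation.Binary.PropositionalEquality
  using (refl; sym; trans; cong; cong₂; subst; subst₂; module ≡-Reasoning)
import Data.Integer as ℤ
import Data.Integer.Properties as ℤ
open import Data.Rational using (ℚ; mkℚ; toℚᵘ)
import Data.Rational as ℚ
import Data.Rational.Properties as ℚ
import Data.Rational.Unnormalised as ℚᵘ
import Data.Rational.Unnormalised.Properties as ℚᵘ
open import Data.Rational.Solver using (module +-*-Solver)

-- Statements about all particles, decided by computation

record Enumeration (A : Set) : Set where
  field
    size       : ℕ
    element    : Fin size → A
    surjective : ∀ x → ∃ λ i → element i ≡ x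

  all? : {P : A → Set} → Decidable P → Dec (∀ x → P x)
  all? {P} P? = map′ (λ ∀P x → subst P (proj₂ (surjective x)) (∀P (proj₁ (surjective x))))
                     (λ ∀P i → ∀P (element i))
                     (Fin.all? (P? ∘ element))

allFermions : Vec Fermion 8
allFermions = E ∷ M ∷ U ∷ D ∷ S ∷ C ∷ B ∷ T ∷ []

fermionIndex : ∀ g → ∃ λ i → Vec.lookup allFermions i ≡ g
fermionIndex E = # 0 , refl
fermionIndex M = # 1 , refl
fermionIndex U = # 2 , refl
fermionIndex D = # 3 , refl
fermionIndex S = # 4 , refl
fermionIndex C = # 5 , refl
fermionIndex B = # 6 , refl
fermionIndex T = # 7 , refl

fermionEnumeration : Enumeration Fermion
fermionEnumeration = record { size = 8 ; element = Vec.lookup allFermions ; surjective = fermionIndex }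

allParticles : Vec Particle 24
allParticles = fer E ∷ fer M ∷ fer U ∷ fer D ∷ fer S ∷ fer C ∷ fer B ∷ fer T
  ∷ b211 ∷ b1221 ∷ b112211 ∷ b12221 ∷ b2 ∷ b12 ∷ b1112 ∷ b112 ∷ b2112 ∷ b122112 ∷ b11222112
  ∷ b22112 ∷ b222112 ∷ n22 ∷ n11110 ∷ n11112 ∷ []

particleIndex : ∀ x → ∃ λ i → Vec.lookup allParticles i ≡ x
particleIndex (fer E)   = # 0 , refl
particleIndex (fer M)   = # 1 , refl
particleIndex (fer U)   = # 2 , refl
particleIndex (fer D)   = # 3 , refl
particleIndex (fer S)   = # 4 , refl
particleIndex (fer C)   = # 5 , refl
particleIndex (fer B)   = # 6 , refl
particleIndex (fer T)   = # 7 , refl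
particleIndex b211      = # 8 , refl
particleIndex b1221     = # 9 , refl
particleIndex b112211   = # 10 , refl
particleIndex b12221    = # 11 , refl
particleIndex b2        = # 12 , refl
particleIndex b12       = # 13 , refl
particleIndex b1112     = # 14 , refl
particleIndex b112      = # 15 , refl
particleIndex b2112     = # 16 , refl
particleIndex b122112   = # 17 , refl
particleIndex b11222112 = # 18 , refl
particleIndex b22112    = # 19 , refl
particleIndex b222112   = # 20 , refl
particleIndex n22       = # 21 , refl
particleIndex n11110    = # 22 , refl
particleIndex n11112    = # 23 , refl

particleEnumeration : Enumeration Particle
particleEnumeration = record { size = 24 ; element = Vec.lookup allParticles ; surjective = particleIndex }

open Enumeration fermionEnumeration using () renaming (all? to ∀-fermion?)
open Enumeration particleEnumeration using () renaming (all? to ∀-particle?)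

-- The bosons of the cycle 211 → 1221 → 112211 → 2.12221 → M.211: only they create new
-- non-fermions (112211 emits the boson 2), and their number never increases.
isCyclic : Particle → Bool
isCyclic b211    = true
isCyclic b1221   = true
isCyclic b112211 = true
isCyclic b12221  = true
isCyclic _       = false

count : Fermion → List Particle → ℕ
count f = countB (isThe f)

fermions nonFermions cyclicBosons : List Particle → ℕ
fermions     = countB isFermion
nonFermions  = countB isNonFermion
cyclicBosons = countB isCyclic

data Kind : Particle → Set where
  fermion    : ∀ g → Kind (fer g)
  nonFermion : ∀ {x} → nonFermions [ x ] ≡ 1 → Dec (IsNeutrino x) → Kind x

kind : ∀ x → Kind x
kind (fer g)   = fermion g
kind b211      = nonFermion refl (no λ ())
kind b1221     = nonFermion refl (no λ ())
kind b112211   = nonFermion refl (no λ ())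
kind b12221    = nonFermion refl (no λ ())
kind b2        = nonFermion refl (no λ ())
kind b12       = nonFermion refl (no λ ())
kind b1112     = nonFermion refl (no λ ())
kind b112      = nonFermion refl (no λ ())
kind b2112     = nonFermion refl (no λ ())
kind b122112   = nonFermion refl (no λ ())
kind b11222112 = nonFermion refl (no λ ())
kind b22112    = nonFermion refl (no λ ())
kind b222112   = nonFermion refl (no λ ())
kind n22       = nonFermion refl (yes ν22)
kind n11110    = nonFermion refl (yes ν11110)
kind n11112    = nonFermion refl (yes ν11112)

neutrino? : Decidable IsNeutrino
neutrino? x with kind x
... | fermion _       = no λ ()
... | nonFermion _ ν? = ν?

countB-++ : ∀ P xs ys → countB P (xs ++ ys) ≡ countB P xs + countB P ys
countB-++ P []       ys = refl
countB-++ P (x ∷ xs) ys with P x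
... | true  = cong suc (countB-++ P xs ys)
... | false = countB-++ P xs ys

countB≤length : ∀ P xs → countB P xs ≤ length xs
countB≤length P []       = z≤n
countB≤length P (x ∷ xs) with P x
... | true  = s≤s (countB≤length P xs)
... | false = m≤n⇒m≤1+n (countB≤length P xs)

record Additive (μ : List Particle → ℕ) : Set where
  field
    additive-[] : μ [] ≡ 0
    additive-++ : ∀ xs ys → μ (xs ++ ys) ≡ μ xs + μ ys

open Additive

countB-additive : ∀ P → Additive (countB P)
countB-additive P = record { additive-[] = refl ; additive-++ = countB-++ P }

length-additive : Additive length
length-additive = record { additive-[] = refl ; additive-++ = λ xs ys → length-++ xs }

*-additive : ∀ a {μ} → Additive μ → Additive (λ xs → a * μ xs)
*-additive a μ-add = record
  { additive-[] = trans (cong (a *_) (additive-[] μ-add)) (*-zeroʳ a)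
  ; additive-++ = λ xs ys → trans (cong (a *_) (additive-++ μ-add xs ys)) (*-distribˡ-+ a _ _)
  }

+-additive : ∀ {μ ν} → Additive μ → Additive ν → Additive (λ xs → μ xs + ν xs)
+-additive {μ} {ν} μ-add ν-add = record
  { additive-[] = cong₂ _+_ (additive-[] μ-add) (additive-[] ν-add)
  ; additive-++ = λ xs ys → trans (cong₂ _+_ (additive-++ μ-add xs ys) (additive-++ ν-add xs ys))
                                  (+-interchange (μ xs) (μ ys) (ν xs) (ν ys))
  }

additive-≤ : ∀ {μ ν} → Additive μ → Additive ν → (∀ x → μ [ x ] ≤ ν [ x ]) → ∀ xs → μ xs ≤ ν xs
additive-≤ μ-add ν-add le [] = ≤-trans (≤-reflexive (additive-[] μ-add)) z≤n
additive-≤ {μ} {ν} μ-add ν-add le (x ∷ xs) = begin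
  μ ([ x ] ++ xs)    ≡⟨ additive-++ μ-add [ x ] xs ⟩
  μ [ x ] + μ xs     ≤⟨ +-mono-≤ (le x) (additive-≤ μ-add ν-add le xs) ⟩
  ν [ x ] + ν xs     ≡⟨ additive-++ ν-add [ x ] xs ⟨
  ν ([ x ] ++ xs)    ∎
  where open ≤-Reasoning

decomp-[] : ∀ k → decomp k [] ≡ []
decomp-[] zero    = refl
decomp-[] (suc k) = cong (concatMap image) (decomp-[] k)

decomp-++ : ∀ k xs ys → decomp k (xs ++ ys) ≡ decomp k xs ++ decomp k ys
decomp-++ zero    xs ys = refl
decomp-++ (suc k) xs ys =
  trans (cong (concatMap image) (decomp-++ k xs ys)) (concatMap-++ image (decomp k xs) (decomp k ys))

decomp-+ : ∀ j k xs → decomp (j + k) xs ≡ decomp j (decomp k xs)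
decomp-+ zero    k xs = refl
decomp-+ (suc j) k xs = cong (concatMap image) (decomp-+ j k xs)

decomp-additive : ∀ k {μ} → Additive μ → Additive (μ ∘ decomp k)
decomp-additive k {μ} μ-add = record
  { additive-[] = trans (cong μ (decomp-[] k)) (additive-[] μ-add)
  ; additive-++ = λ xs ys → trans (cong μ (decomp-++ k xs ys)) (additive-++ μ-add (decomp k xs) (decomp k ys))
  }

fermions-mono-single : ∀ x → fermions [ x ] ≤ fermions (decomp 1 [ x ])
fermions-mono-single = from-yes (∀-particle? λ x → fermions [ x ] ≤? fermions (decomp 1 [ x ]))

fermions-double-single : ∀ x → 2 * fermions [ x ] ≤ fermions (decomp 14 [ x ])
fermions-double-single = from-yes (∀-particle? λ x → 2 * fermions [ x ] ≤? fermions (decomp 14 [ x ]))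

length-step-single : ∀ x → length (decomp 1 [ x ]) ≤ 2 * length [ x ]
length-step-single = from-yes (∀-particle? λ x → length (decomp 1 [ x ]) ≤? 2 * length [ x ])

cyclicBosons-step-single : ∀ x → cyclicBosons (decomp 1 [ x ]) ≤ cyclicBosons [ x ]
cyclicBosons-step-single = from-yes (∀-particle? λ x → cyclicBosons (decomp 1 [ x ]) ≤? cyclicBosons [ x ])

nonFermions-step-single : ∀ x → nonFermions (decomp 1 [ x ]) ≤ nonFermions [ x ] + cyclicBosons [ x ]
nonFermions-step-single =
  from-yes (∀-particle? λ x → nonFermions (decomp 1 [ x ]) ≤? nonFermions [ x ] + cyclicBosons [ x ])

cyclicBosons≤nonFermions-single : ∀ x → cyclicBosons [ x ] ≤ nonFermions [ x ]
cyclicBosons≤nonFermions-single = from-yes (∀-particle? λ x → cyclicBosons [ x ] ≤? nonFermions [ x ])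

neutrino-or-fermion-within-4 : ∀ x → IsNeutrino x ⊎ 1 ≤ fermions (decomp 4 [ x ])
neutrino-or-fermion-within-4 = from-yes (∀-particle? λ x → neutrino? x ⊎-dec 1 ≤? fermions (decomp 4 [ x ]))

fermions-mono : ∀ xs → fermions xs ≤ fermions (decomp 1 xs)
fermions-mono = additive-≤ (countB-additive isFermion) (decomp-additive 1 (countB-additive isFermion))
                           fermions-mono-single

fermions-double : ∀ xs → 2 * fermions xs ≤ fermions (decomp 14 xs)
fermions-double = additive-≤ (*-additive 2 (countB-additive isFermion))
                             (decomp-additive 14 (countB-additive isFermion)) fermions-double-single

length-decomp : ∀ k xs → length (decomp k xs) ≤ 2 ^ k * length xs
length-decomp zero    xs = ≤-reflexive (sym (+-identityʳ (length xs)))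
length-decomp (suc k) xs = begin
  length (decomp 1 (decomp k xs)) ≤⟨ additive-≤ (decomp-additive 1 length-additive)
                                                 (*-additive 2 length-additive) length-step-single (decomp k xs) ⟩
  2 * length (decomp k xs)        ≤⟨ *-monoʳ-≤ 2 (length-decomp k xs) ⟩
  2 * (2 ^ k * length xs)         ≡⟨ *-assoc 2 (2 ^ k) (length xs) ⟨
  2 ^ suc k * length xs           ∎
  where open ≤-Reasoning

cyclicBosons-decomp : ∀ n xs → cyclicBosons (decomp n xs) ≤ cyclicBosons xs
cyclicBosons-decomp zero    xs = ≤-refl
cyclicBosons-decomp (suc n) xs =
  ≤-trans (additive-≤ (decomp-additive 1 (countB-additive isCyclic)) (countB-additive isCyclic)
                      cyclicBosons-step-single (decomp n xs))
          (cyclicBosons-decomp n xs)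

nonFermions-decomp : ∀ n xs → nonFermions (decomp n xs) ≤ suc n * nonFermions xs
nonFermions-decomp zero    xs = ≤-reflexive (sym (+-identityʳ (nonFermions xs)))
nonFermions-decomp (suc n) xs = begin
  nonFermions (decomp 1 (decomp n xs))
    ≤⟨ additive-≤ (decomp-additive 1 nonFermions-additive) (+-additive nonFermions-additive cyclic-additive)
                  nonFermions-step-single (decomp n xs) ⟩
  nonFermions (decomp n xs) + cyclicBosons (decomp n xs)
    ≤⟨ +-mono-≤ (nonFermions-decomp n xs) (cyclicBosons-decomp n xs) ⟩
  suc n * nonFermions xs + cyclicBosons xs
    ≤⟨ +-monoʳ-≤ (suc n * nonFermions xs)
                 (additive-≤ cyclic-additive nonFermions-additive cyclicBosons≤nonFermions-single xs) ⟩
  suc n * nonFermions xs + nonFermions xs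
    ≡⟨ +-comm (suc n * nonFermions xs) (nonFermions xs) ⟩
  suc (suc n) * nonFermions xs ∎
  where
    open ≤-Reasoning
    nonFermions-additive : Additive nonFermions
    nonFermions-additive = countB-additive isNonFermion
    cyclic-additive : Additive cyclicBosons
    cyclic-additive = countB-additive isCyclic

fermions-within-4 : ∀ xs → ¬ All IsNeutrino xs → 1 ≤ fermions (decomp 4 xs)
fermions-within-4 []       ¬allν = ⊥-elim (¬allν [])
fermions-within-4 (x ∷ xs) ¬allν
  rewrite additive-++ (decomp-additive 4 (countB-additive isFermion)) [ x ] xs
  with neutrino-or-fermion-within-4 x
... | inj₁ ν  = ≤-trans (fermions-within-4 xs (¬allν ∘ (ν ∷_))) (m≤n+m _ _)
... | inj₂ h  = ≤-trans h (m≤m+n _ _)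

Eventually : (ℕ → Set) → Set
Eventually P = ∃ λ N → ∀ n → N ≤ n → P n

eventually-mono : ∀ {P Q : ℕ → Set} → (∀ {n} → P n → Q n) → Eventually P → Eventually Q
eventually-mono P⇒Q (N , P-from-N) = N , λ n N≤n → P⇒Q (P-from-N n N≤n)

eventually-≥ : ∀ {P : ℕ → Set} k → Eventually P → Eventually (λ n → k ≤ n × P n)
eventually-≥ k (N , P-from-N) =
  k + N , λ n k+N≤n → ≤-trans (m≤m+n k N) k+N≤n , P-from-N n (≤-trans (m≤n+m N k) k+N≤n)

eventually-from : ∀ {P : ℕ → Set} m₀ → P m₀ → (∀ {m} → P m → P (suc m)) → Eventually P
eventually-from {P} m₀ base step = m₀ , λ n m₀≤n → from (≤⇒≤′ m₀≤n)
  where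
    from : ∀ {n} → m₀ ≤′ n → P n
    from ≤′-refl      = base
    from (≤′-step le) = step (from le)

n<2^n : ∀ n → n < 2 ^ n
n<2^n zero    = s≤s z≤n
n<2^n (suc n) = +-mono-≤ (≤-trans (s≤s z≤n) (n<2^n n)) (≤-trans (n<2^n n) (m≤m+n (2 ^ n) 0))

linear<exponential : ∀ c → Eventually (λ m → c * suc m < 2 ^ m)
linear<exponential c = eventually-from (a + a) base step
  where
    a : ℕ
    a = suc (2 * c)

    square-gap : ∀ x → suc (suc (2 * x)) * suc (suc (2 * x))
                     ≡ suc (x * suc (suc (2 * x) + suc (2 * x))) + (5 * x + 3)
    square-gap = solve-∀

    base : c * suc (a + a) < 2 ^ (a + a)
    base = begin-strict
      c * suc (a + a)  <⟨ ≤-trans (m≤m+n _ _) (≤-reflexive (sym (square-gap c))) ⟩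
      suc a * suc a    ≤⟨ *-mono-≤ (n<2^n a) (n<2^n a) ⟩
      2 ^ a * 2 ^ a    ≡⟨ ^-distribˡ-+-* 2 a a ⟨
      2 ^ (a + a)      ∎
      where open ≤-Reasoning

    step : ∀ {m} → c * suc m < 2 ^ m → c * suc (suc m) < 2 ^ suc m
    step {m} h = begin-strict
      c * suc (suc m)          ≡⟨ *-suc c (suc m) ⟩
      c + c * suc m            ≤⟨ +-monoˡ-≤ (c * suc m) (m≤m*n c (suc m)) ⟩
      c * suc m + c * suc m    <⟨ +-mono-< h h ⟩
      2 ^ m + 2 ^ m            ≡⟨ cong (2 ^ m +_) (+-identityʳ (2 ^ m)) ⟨
      2 ^ suc m                ∎
      where open ≤-Reasoning

module Doubling (g : ℕ → ℕ) (g-step : ∀ n → g n ≤ g (suc n))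
                (d : ℕ) .{{_ : NonZero d}} (g-double : ∀ n → 2 * g n ≤ g (d + n))
                (n₀ : ℕ) (g-start : 1 ≤ g n₀) where

  g-mono : ∀ {m n} → m ≤ n → g m ≤ g n
  g-mono m≤n = from (≤⇒≤′ m≤n)
    where
      from : ∀ {m n} → m ≤′ n → g m ≤ g n
      from ≤′-refl      = ≤-refl
      from (≤′-step le) = ≤-trans (from le) (g-step _)

  2^≤g : ∀ m → 2 ^ m ≤ g (m * d + n₀)
  2^≤g zero    = g-start
  2^≤g (suc m) = begin
    2 * 2 ^ m              ≤⟨ *-monoʳ-≤ 2 (2^≤g m) ⟩
    2 * g (m * d + n₀)     ≤⟨ g-double (m * d + n₀) ⟩
    g (d + (m * d + n₀))   ≡⟨ cong g (+-assoc d (m * d) n₀) ⟨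
    g (suc m * d + n₀)     ∎
    where open ≤-Reasoning

  linear<g : ∀ K → Eventually (λ n → K * suc n < g n)
  linear<g K with linear<exponential (K * (d + n₀))
  ... | m₀ , beats = m₀ * d + n₀ , bound
    where
      -- with m = (n ∸ n₀)/d, n lies between m * d + n₀ and (m + 1) * d + n₀
      bound : ∀ n → m₀ * d + n₀ ≤ n → K * suc n < g n
      bound n N≤n = begin-strict
        K * suc n                   ≤⟨ *-monoʳ-≤ K suc-n≤ ⟩
        K * ((d + n₀) * suc m)      ≡⟨ *-assoc K (d + n₀) (suc m) ⟨
        K * (d + n₀) * suc m        <⟨ beats m m₀≤m ⟩
        2 ^ m                       ≤⟨ 2^≤g m ⟩
        g (m * d + n₀)              ≤⟨ g-mono md+n₀≤n ⟩
        g n                         ∎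
        where
          open ≤-Reasoning
          t m : ℕ
          t = n ∸ n₀
          m = t / d
          n₀≤n : n₀ ≤ n
          n₀≤n = ≤-trans (m≤n+m n₀ (m₀ * d)) N≤n
          n≡ : n ≡ n₀ + (t % d + m * d)
          n≡ = trans (sym (m+[n∸m]≡n n₀≤n)) (cong (n₀ +_) (m≡m%n+[m/n]*n t d))
          expand : ∀ a b c → (b + a) * suc c ≡ a + (b + c * b) + a * c
          expand = solve-∀
          md+n₀≤n : m * d + n₀ ≤ n
          md+n₀≤n = ≤-trans (≤-reflexive (+-comm (m * d) n₀))
                            (≤-trans (+-monoʳ-≤ n₀ (m/n*n≤m t d)) (≤-reflexive (m+[n∸m]≡n n₀≤n)))
          m₀≤m : m₀ ≤ m
          m₀≤m = ≤-trans (≤-reflexive (sym (m*n/n≡m m₀ d)))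
                         (/-monoˡ-≤ d (≤-trans (≤-reflexive (sym (m+n∸n≡m (m₀ * d) n₀)))
                                               (∸-monoˡ-≤ n₀ N≤n)))
          suc-n≤ : suc n ≤ (d + n₀) * suc m
          suc-n≤ = begin
            suc n                           ≡⟨ cong suc n≡ ⟩
            suc (n₀ + (t % d + m * d))      ≡⟨ +-suc n₀ (t % d + m * d) ⟨
            n₀ + (suc (t % d) + m * d)      ≤⟨ +-monoʳ-≤ n₀ (+-monoˡ-≤ (m * d) (m%n<n t d)) ⟩
            n₀ + (d + m * d)                ≤⟨ m≤m+n (n₀ + (d + m * d)) (n₀ * m) ⟩
            n₀ + (d + m * d) + n₀ * m       ≡⟨ expand n₀ d m ⟨
            (d + n₀) * suc m                ∎

module _ {n : ℕ} where

  infixl 6 _⊕_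
  infixr 7 _⊙_
  infixl 6 _⊖_

  _⊕_ : Vec ℕ n → Vec ℕ n → Vec ℕ n
  _⊕_ = Vec.zipWith _+_

  _⊙_ : ℕ → Vec ℕ n → Vec ℕ n
  a ⊙ v = Vec.map (a *_) v

  _⊖_ : Vec ℕ n → Vec ℕ n → Vec ℕ n
  _⊖_ = Vec.zipWith _∸_

sum-⊕ : ∀ {n} (u v : Vec ℕ n) → Vec.sum (u ⊕ v) ≡ Vec.sum u + Vec.sum v
sum-⊕ []       []       = refl
sum-⊕ (x ∷ u) (y ∷ v) = trans (cong (x + y +_) (sum-⊕ u v)) (+-interchange x y (Vec.sum u) (Vec.sum v))

sum-⊙ : ∀ {n} a (v : Vec ℕ n) → Vec.sum (a ⊙ v) ≡ a * Vec.sum v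
sum-⊙ a []      = sym (*-zeroʳ a)
sum-⊙ a (x ∷ v) = trans (cong (a * x +_) (sum-⊙ a v)) (sym (*-distribˡ-+ a x (Vec.sum v)))

lookup≤sum : ∀ {n} (v : Vec ℕ n) i → Vec.lookup v i ≤ Vec.sum v
lookup≤sum (x ∷ v) zero    = m≤m+n x (Vec.sum v)
lookup≤sum (x ∷ v) (suc i) = ≤-trans (lookup≤sum v i) (m≤n+m (Vec.sum v) x)

-- The number of each fermion, in the order E M U D S C B T of allFermions.
Census : Set
Census = Vec ℕ 8

index : Fermion → Fin 8
index f = proj₁ (fermionIndex f)

number : Fermion → Census → ℕ
number f v = Vec.lookup v (index f)

total : Census → ℕ
total = Vec.sum

census : List Particle → Census
census xs = Vec.map (λ g → count g xs) allFermions

unit : Fermion → Census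
unit g = census [ fer g ]

one : Census
one = Vec.replicate 8 1

-- One step on the census of a list of fermions, i.e. the matrix M: for instance E comes from
-- M → E.U and from T → E.B.
evolve : Census → Census
evolve (e ∷ m ∷ u ∷ d ∷ s ∷ c ∷ b ∷ t ∷ []) = m + t ∷ e ∷ m ∷ u + c ∷ d ∷ s ∷ c + t ∷ b ∷ []

evolve^ : ℕ → Census → Census
evolve^ zero    v = v
evolve^ (suc k) v = evolve (evolve^ k v)

evolve-⊕ : ∀ u v → evolve (u ⊕ v) ≡ evolve u ⊕ evolve v
evolve-⊕ (e ∷ m ∷ u ∷ d ∷ s ∷ c ∷ b ∷ t ∷ [])
         (e′ ∷ m′ ∷ u′ ∷ d′ ∷ s′ ∷ c′ ∷ b′ ∷ t′ ∷ []) =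
  Pointwise-≡⇒≡ (+-interchange m m′ t t′ ∷ refl ∷ refl ∷ +-interchange u u′ c c′ ∷ refl ∷ refl
                 ∷ +-interchange c c′ t t′ ∷ refl ∷ [])

evolve-⊙ : ∀ a v → evolve (a ⊙ v) ≡ a ⊙ evolve v
evolve-⊙ a (e ∷ m ∷ u ∷ d ∷ s ∷ c ∷ b ∷ t ∷ []) =
  Pointwise-≡⇒≡ (sym (*-distribˡ-+ a m t) ∷ refl ∷ refl ∷ sym (*-distribˡ-+ a u c) ∷ refl ∷ refl
                 ∷ sym (*-distribˡ-+ a c t) ∷ refl ∷ [])

evolve^-⊕ : ∀ k u v → evolve^ k (u ⊕ v) ≡ evolve^ k u ⊕ evolve^ k v
evolve^-⊕ zero    u v = refl
evolve^-⊕ (suc k) u v = trans (cong evolve (evolve^-⊕ k u v)) (evolve-⊕ (evolve^ k u) (evolve^ k v))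

evolve^-⊙ : ∀ k a v → evolve^ k (a ⊙ v) ≡ a ⊙ evolve^ k v
evolve^-⊙ zero    a v = refl
evolve^-⊙ (suc k) a v = trans (cong evolve (evolve^-⊙ k a v)) (evolve-⊙ a (evolve^ k v))

evolve^-+ : ∀ j k v → evolve^ (j + k) v ≡ evolve^ j (evolve^ k v)
evolve^-+ zero    k v = refl
evolve^-+ (suc j) k v = cong evolve (evolve^-+ j k v)

evolve^-zero : ∀ k → evolve^ k (Vec.replicate 8 0) ≡ Vec.replicate 8 0
evolve^-zero zero    = refl
evolve^-zero (suc k) = cong evolve (evolve^-zero k)

number-census : ∀ f xs → number f (census xs) ≡ count f xs
number-census f xs = trans (lookup-map (index f) (λ g → count g xs) allFermions)
                           (cong (λ g → count g xs) (proj₂ (fermionIndex f)))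

census-++ : ∀ xs ys → census (xs ++ ys) ≡ census xs ⊕ census ys
census-++ xs ys = go allFermions
  where
    go : ∀ {n} (gs : Vec Fermion n) →
         Vec.map (λ g → count g (xs ++ ys)) gs ≡ Vec.map (λ g → count g xs) gs ⊕ Vec.map (λ g → count g ys) gs
    go []       = refl
    go (g ∷ gs) = cong₂ _∷_ (countB-++ (isThe g) xs ys) (go gs)

IsFermion : Particle → Set
IsFermion x = ∃ λ g → fer g ≡ x

fermion? : Decidable IsFermion
fermion? x with kind x
... | fermion g       = yes (g , refl)
... | nonFermion nf _ = no λ { (_ , refl) → 0≢1+n nf }

image-fermionic : ∀ g → All IsFermion (decomp 1 [ fer g ])
image-fermionic = from-yes (∀-fermion? λ g → All.all? fermion? (decomp 1 [ fer g ]))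

census-image : ∀ g → census (decomp 1 [ fer g ]) ≡ evolve (unit g)
census-image = from-yes (∀-fermion? λ g → ≡-dec _≟_ (census (decomp 1 [ fer g ])) (evolve (unit g)))

total-unit : ∀ g → total (unit g) ≡ 1
total-unit = from-yes (∀-fermion? λ g → total (unit g) ≟ 1)

decomp-fermionic : ∀ k {xs} → All IsFermion xs → All IsFermion (decomp k xs)
decomp-fermionic zero    fs = fs
decomp-fermionic (suc k) fs = step (decomp-fermionic k fs)
  where
    step : ∀ {xs} → All IsFermion xs → All IsFermion (decomp 1 xs)
    step []                       = []
    step {_ ∷ xs} ((g , refl) ∷ fs) =
      subst (All IsFermion) (sym (decomp-++ 1 [ fer g ] xs)) (++⁺ (image-fermionic g) (step fs))

census-step : ∀ {xs} → All IsFermion xs → census (decomp 1 xs) ≡ evolve (census xs)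
census-step []                          = refl
census-step {_ ∷ xs} ((g , refl) ∷ fs) = begin
  census (decomp 1 ([ fer g ] ++ xs))                 ≡⟨ cong census (decomp-++ 1 [ fer g ] xs) ⟩
  census (decomp 1 [ fer g ] ++ decomp 1 xs)          ≡⟨ census-++ (decomp 1 [ fer g ]) (decomp 1 xs) ⟩
  census (decomp 1 [ fer g ]) ⊕ census (decomp 1 xs)  ≡⟨ cong₂ _⊕_ (census-image g) (census-step fs) ⟩
  evolve (unit g) ⊕ evolve (census xs)                ≡⟨ evolve-⊕ (unit g) (census xs) ⟨
  evolve (unit g ⊕ census xs)                         ≡⟨ cong evolve (census-++ [ fer g ] xs) ⟨
  evolve (census (fer g ∷ xs))                        ∎
  where open ≡-Reasoning

census-decomp : ∀ k g → census (decomp k [ fer g ]) ≡ evolve^ k (unit g)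
census-decomp zero    g = refl
census-decomp (suc k) g =
  trans (census-step (decomp-fermionic k ((g , refl) ∷ []))) (cong evolve (census-decomp k g))

length-census : ∀ {xs} → All IsFermion xs → length xs ≡ total (census xs)
length-census []                          = refl
length-census {_ ∷ xs} ((g , refl) ∷ fs) = begin
  suc (length xs)                   ≡⟨ cong₂ _+_ (total-unit g) (sym (length-census fs)) ⟨
  total (unit g) + total (census xs) ≡⟨ sum-⊕ (unit g) (census xs) ⟨
  total (unit g ⊕ census xs)        ≡⟨ cong total (census-++ [ fer g ] xs) ⟨
  total (census (fer g ∷ xs))       ∎
  where open ≡-Reasoning

-- Enclosures of the proportion of a fermion

-- lo/den ≤ c/l ≤ hi/den, cross-multiplied.
record Between (lo hi den c l : ℕ) : Set where
  constructor between
  field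
    lower : lo * l ≤ den * c
    upper : den * c ≤ hi * l

between? : ∀ lo hi den c l → Dec (Between lo hi den c l)
between? lo hi den c l =
  map′ (uncurry between) (λ b → Between.lower b , Between.upper b) (lo * l ≤? den * c ×-dec den * c ≤? hi * l)

between-zero : ∀ lo hi den → Between lo hi den 0 0
between-zero lo hi den = between (≤-reflexive (trans (*-zeroʳ lo) (sym (*-zeroʳ den))))
                                 (≤-reflexive (trans (*-zeroʳ den) (sym (*-zeroʳ hi))))

between-+ : ∀ {lo hi den c l c′ l′} → Between lo hi den c l → Between lo hi den c′ l′ →
            Between lo hi den (c + c′) (l + l′)
between-+ {lo} {hi} {den} {c} {l} {c′} {l′} (between lower upper) (between lower′ upper′) = between
  (subst₂ _≤_ (sym (*-distribˡ-+ lo l l′)) (sym (*-distribˡ-+ den c c′)) (+-mono-≤ lower lower′))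
  (subst₂ _≤_ (sym (*-distribˡ-+ den c c′)) (sym (*-distribˡ-+ hi l l′)) (+-mono-≤ upper upper′))

rearrangement : ∀ {a b c d} → a ≤ b → c ≤ d → a * d + b * c ≤ a * c + b * d
rearrangement {a} {_} {c} h₁ h₂ with m≤n⇒∃[o]m+o≡n h₁ | m≤n⇒∃[o]m+o≡n h₂
... | x , refl | y , refl = ≤-trans (m≤m+n _ (x * y)) (≤-reflexive (expand a x c y))
  where
    expand : ∀ a x c y → a * (c + y) + (a + x) * c + x * y ≡ a * c + (a + x) * (c + y)
    expand = solve-∀

-- If s/σ and r/ρ lie in [lo/den, hi/den] and ρ ≤ w σ, then (s + r)/(σ + ρ) lies between
-- (s/σ + w lo/den)/(1 + w) and (s/σ + w hi/den)/(1 + w), an interval w/(1 + w) times as wide.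
mediant : ∀ w {lo hi den s σ r ρ} → Between lo hi den s σ → Between lo hi den r ρ → ρ ≤ w * σ →
          Between (den * s + w * (lo * σ)) (den * s + w * (hi * σ)) (suc w * (den * σ)) (s + r) (σ + ρ)
mediant w {lo} {hi} {den} {s} {σ} {r} {ρ} (between lo-s s-hi) (between lo-r r-hi) ρ≤wσ = between lower upper
  where
    open ≤-Reasoning

    factor-mediant : ∀ w den s σ r → suc w * (den * σ) * s + suc w * σ * (den * r) ≡ suc w * (den * σ) * (s + r)
    factor-mediant = solve-∀

    lower : (den * s + w * (lo * σ)) * (σ + ρ) ≤ suc w * (den * σ) * (s + r)
    lower = begin
      (den * s + w * (lo * σ)) * (σ + ρ)
        ≡⟨ expand-lower w lo den s σ ρ ⟩
      den * s * σ + w * lo * σ * ρ + (lo * σ * (w * σ) + den * s * ρ)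
        ≤⟨ +-monoʳ-≤ (den * s * σ + w * lo * σ * ρ) (rearrangement lo-s ρ≤wσ) ⟩
      den * s * σ + w * lo * σ * ρ + (lo * σ * ρ + den * s * (w * σ))
        ≡⟨ collect-lower w lo den s σ ρ ⟩
      suc w * (den * σ) * s + suc w * σ * (lo * ρ)
        ≤⟨ +-monoʳ-≤ (suc w * (den * σ) * s) (*-monoʳ-≤ (suc w * σ) lo-r) ⟩
      suc w * (den * σ) * s + suc w * σ * (den * r)
        ≡⟨ factor-mediant w den s σ r ⟩
      suc w * (den * σ) * (s + r) ∎
      where
        expand-lower : ∀ w lo den s σ ρ → (den * s + w * (lo * σ)) * (σ + ρ)
                              ≡ den * s * σ + w * lo * σ * ρ + (lo * σ * (w * σ) + den * s * ρ)
        expand-lower = solve-∀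
        collect-lower : ∀ w lo den s σ ρ → den * s * σ + w * lo * σ * ρ + (lo * σ * ρ + den * s * (w * σ))
                              ≡ suc w * (den * σ) * s + suc w * σ * (lo * ρ)
        collect-lower = solve-∀

    upper : suc w * (den * σ) * (s + r) ≤ (den * s + w * (hi * σ)) * (σ + ρ)
    upper = begin
      suc w * (den * σ) * (s + r)
        ≡⟨ factor-mediant w den s σ r ⟨
      suc w * (den * σ) * s + suc w * σ * (den * r)
        ≤⟨ +-monoʳ-≤ (suc w * (den * σ) * s) (*-monoʳ-≤ (suc w * σ) r-hi) ⟩
      suc w * (den * σ) * s + suc w * σ * (hi * ρ)
        ≡⟨ spread-upper w hi den s σ ρ ⟩
      den * s * σ + w * hi * σ * ρ + (den * s * (w * σ) + hi * σ * ρ)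
        ≤⟨ +-monoʳ-≤ (den * s * σ + w * hi * σ * ρ) (rearrangement s-hi ρ≤wσ) ⟩
      den * s * σ + w * hi * σ * ρ + (den * s * ρ + hi * σ * (w * σ))
        ≡⟨ factor-upper w hi den s σ ρ ⟩
      (den * s + w * (hi * σ)) * (σ + ρ) ∎
      where
        spread-upper : ∀ w hi den s σ ρ → suc w * (den * σ) * s + suc w * σ * (hi * ρ)
                              ≡ den * s * σ + w * hi * σ * ρ + (den * s * (w * σ) + hi * σ * ρ)
        spread-upper = solve-∀
        factor-upper : ∀ w hi den s σ ρ → den * s * σ + w * hi * σ * ρ + (den * s * ρ + hi * σ * (w * σ))
                              ≡ (den * s + w * (hi * σ)) * (σ + ρ)
        factor-upper = solve-∀

Encloses : Fermion → (lo hi den : ℕ) → Census → Set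
Encloses f lo hi den v = Between lo hi den (number f v) (total v)

number-⊕ : ∀ f u v → number f (u ⊕ v) ≡ number f u + number f v
number-⊕ f u v = lookup-zipWith _+_ (index f) u v

encloses-⊕ : ∀ {f lo hi den} u v → Between lo hi den (number f u + number f v) (total u + total v) →
             Encloses f lo hi den (u ⊕ v)
encloses-⊕ {f} {lo} {hi} {den} u v =
  subst₂ (Between lo hi den) (sym (number-⊕ f u v)) (sym (sum-⊕ u v))

module _ {P : Census → Set} (P-zero : P (Vec.replicate 8 0)) (P-⊕ : ∀ {u v} → P u → P v → P (u ⊕ v))
         (k : ℕ) (P-columns : ∀ g → P (evolve^ k (unit g))) where

  evolve^-closure : ∀ v → P (evolve^ k v)
  evolve^-closure (e ∷ m ∷ u ∷ d ∷ s ∷ c ∷ b ∷ t ∷ []) = by-counts e m u d s c b t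
    where
      add : ∀ g {v} → P (evolve^ k v) → P (evolve^ k (unit g ⊕ v))
      add g {v} Pv = subst P (sym (evolve^-⊕ k (unit g) v)) (P-⊕ (P-columns g) Pv)

      -- unit g ⊕ v computes to v with its g-entry increased by one
      by-counts : ∀ e m u d s c b t → P (evolve^ k (e ∷ m ∷ u ∷ d ∷ s ∷ c ∷ b ∷ t ∷ []))
      by-counts 0 0 0 0 0 0 0 0       = subst P (sym (evolve^-zero k)) P-zero
      by-counts (suc e) m u d s c b t = add E (by-counts e m u d s c b t)
      by-counts 0 (suc m) u d s c b t = add M (by-counts 0 m u d s c b t)
      by-counts 0 0 (suc u) d s c b t = add U (by-counts 0 0 u d s c b t)
      by-counts 0 0 0 (suc d) s c b t = add D (by-counts 0 0 0 d s c b t)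
      by-counts 0 0 0 0 (suc s) c b t = add S (by-counts 0 0 0 0 s c b t)
      by-counts 0 0 0 0 0 (suc c) b t = add C (by-counts 0 0 0 0 0 c b t)
      by-counts 0 0 0 0 0 0 (suc b) t = add B (by-counts 0 0 0 0 0 0 b t)
      by-counts 0 0 0 0 0 0 0 (suc t) = add T (by-counts 0 0 0 0 0 0 0 t)

-- Every entry of M¹⁴ lies between 1 and 17: each column of M¹⁴ is the all-ones vector plus an
-- excess with entries at most 16.
excess : Fermion → Census
excess g = evolve^ 14 (unit g) ⊖ one

M¹⁴-column : ∀ g → evolve^ 14 (unit g) ≡ one ⊕ excess g
M¹⁴-column = from-yes (∀-fermion? λ g → ≡-dec _≟_ (evolve^ 14 (unit g)) (one ⊕ excess g))

excess≤16 : ∀ g → excess g ⊕ (16 ⊙ one ⊖ excess g) ≡ 16 ⊙ one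
excess≤16 = from-yes (∀-fermion? λ g → ≡-dec _≟_ (excess g ⊕ (16 ⊙ one ⊖ excess g)) (16 ⊙ one))

total-evolve : ∀ v → total v ≤ total (evolve v)
total-evolve (e ∷ m ∷ u ∷ d ∷ s ∷ c ∷ b ∷ t ∷ []) =
  ≤-trans (m≤m+n _ (m + c + t)) (≤-reflexive (expand e m u d s c b t))
  where
    expand : ∀ e m u d s c b t → e + (m + (u + (d + (s + (c + (b + (t + 0))))))) + (m + c + t)
                               ≡ m + t + (e + (m + (u + c + (d + (s + (c + t + (b + 0)))))))
    expand = solve-∀

total-evolve^ : ∀ k v → total v ≤ total (evolve^ k v)
total-evolve^ zero    v = ≤-refl
total-evolve^ (suc k) v = ≤-trans (total-evolve^ k v) (total-evolve (evolve^ k v))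

record Enclosure (f : Fermion) (k : ℕ) : Set where
  field
    lo hi den : ℕ
    lo≤den    : lo ≤ den
    den≢0     : NonZero den
    columns   : ∀ g → Encloses f lo hi den (evolve^ k (unit g))

  encloses : ∀ v → Encloses f lo hi den (evolve^ k v)
  encloses = evolve^-closure {P = Encloses f lo hi den} zero-encloses
                             (λ {u} {v} eu ev → encloses-⊕ {f} u v (between-+ eu ev)) k columns
    where
      zero-encloses : Encloses f lo hi den (Vec.replicate 8 0)
      zero-encloses = subst (λ c → Between lo hi den c 0) (sym (lookup-replicate (index f) 0))
                            (between-zero lo hi den)

-- Column g of M^(k+14) is M^k·1 plus M^k applied to the excess, whose total is at most 16 times
-- that of M^k·1; mediant then narrows the enclosure around the proportion of f in M^k·1.
contract : ∀ {f k} → Enclosure f k → Enclosure f (k + 14)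
contract {f} {k} enc = record
  { lo      = lo′
  ; hi      = hi′
  ; den     = den′
  ; lo≤den  = +-mono-≤ (*-monoʳ-≤ den (lookup≤sum common (index f))) (*-monoʳ-≤ 16 (*-monoˡ-≤ σ lo≤den))
  ; den≢0   = m*n≢0 17 (den * σ) {{_}} {{m*n≢0 den σ {{den≢0}} {{>-nonZero σ>0}}}}
  ; columns = column
  }
  where
    open Enclosure enc
    common : Census
    common = evolve^ k one
    s σ lo′ hi′ den′ : ℕ
    s    = number f common
    σ    = total common
    lo′  = den * s + 16 * (lo * σ)
    hi′  = den * s + 16 * (hi * σ)
    den′ = 17 * (den * σ)

    σ>0 : 0 < σ
    σ>0 = ≤-trans (s≤s z≤n) (total-evolve^ k one)

    column : ∀ g → Encloses f lo′ hi′ den′ (evolve^ (k + 14) (unit g))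
    column g = subst (Encloses f lo′ hi′ den′) (sym split)
                     (encloses-⊕ {f} common R (mediant 16 (encloses one) (encloses (excess g)) ρ≤16σ))
      where
        R : Census
        R = evolve^ k (excess g)
        split : evolve^ (k + 14) (unit g) ≡ common ⊕ R
        split = begin
          evolve^ (k + 14) (unit g)       ≡⟨ evolve^-+ k 14 (unit g) ⟩
          evolve^ k (evolve^ 14 (unit g)) ≡⟨ cong (evolve^ k) (M¹⁴-column g) ⟩
          evolve^ k (one ⊕ excess g)      ≡⟨ evolve^-⊕ k one (excess g) ⟩
          common ⊕ R                      ∎
          where open ≡-Reasoning
        ρ≤16σ : total R ≤ 16 * σ
        ρ≤16σ = begin
          total R                                            ≤⟨ m≤m+n (total R) _ ⟩
          total R + total (evolve^ k (16 ⊙ one ⊖ excess g))  ≡⟨ sum-⊕ R _ ⟨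
          total (R ⊕ evolve^ k (16 ⊙ one ⊖ excess g))        ≡⟨ cong total (evolve^-⊕ k (excess g) _) ⟨
          total (evolve^ k (excess g ⊕ (16 ⊙ one ⊖ excess g))) ≡⟨ cong (total ∘ evolve^ k) (excess≤16 g) ⟩
          total (evolve^ k (16 ⊙ one))                       ≡⟨ cong total (evolve^-⊙ k 16 one) ⟩
          total (16 ⊙ common)                                ≡⟨ sum-⊙ 16 common ⟩
          16 * σ                                             ∎
          where open ≤-Reasoning

-- The width (hi - lo)/den is at most (16/17)^m.
Width : ∀ {f k} → ℕ → Enclosure f k → Set
Width m enc = 17 ^ m * hi ≤ 17 ^ m * lo + 16 ^ m * den
  where open Enclosure enc

contract-width : ∀ {f k} m (enc : Enclosure f k) → Width m enc → Width (suc m) (contract enc)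
contract-width {f} {k} m enc width = begin
  17 * X * (den * s + 16 * (hi * σ))                   ≡⟨ pull-hi X den s hi σ ⟩
  17 * X * (den * s) + 17 * 16 * σ * (X * hi)          ≤⟨ +-monoʳ-≤ (17 * X * (den * s)) (*-monoʳ-≤ (17 * 16 * σ) width) ⟩
  17 * X * (den * s) + 17 * 16 * σ * (X * lo + Y * den) ≡⟨ push-lo X Y den s lo σ ⟩
  17 * X * (den * s + 16 * (lo * σ)) + 16 * Y * (17 * (den * σ)) ∎
  where
    open ≤-Reasoning
    open Enclosure enc
    X Y s σ : ℕ
    X = 17 ^ m
    Y = 16 ^ m
    s = number f (evolve^ k one)
    σ = total (evolve^ k one)
    pull-hi : ∀ X den s hi σ → 17 * X * (den * s + 16 * (hi * σ)) ≡ 17 * X * (den * s) + 17 * 16 * σ * (X * hi)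
    pull-hi = solve-∀
    push-lo : ∀ X Y den s lo σ → 17 * X * (den * s) + 17 * 16 * σ * (X * lo + Y * den)
                          ≡ 17 * X * (den * s + 16 * (lo * σ)) + 16 * Y * (17 * (den * σ))
    push-lo = solve-∀

trivial-enclosure : ∀ f → Enclosure f 0
trivial-enclosure f = record
  { lo = 0 ; hi = 1 ; den = 1 ; lo≤den = z≤n ; den≢0 = _
  ; columns = λ g → between z≤n (*-monoʳ-≤ 1 (lookup≤sum (unit g) (index f)))
  }

enclosures : ∀ f m → ∃ λ k → Σ (Enclosure f k) (Width m)
enclosures f zero    = 0 , trivial-enclosure f , ≤-refl
enclosures f (suc m) with enclosures f m
... | k , enc , width = k + 14 , contract enc , contract-width m enc width

decimal-enclosure : ∀ f → Enclosure f 147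
decimal-enclosure f = record
  { lo      = 10 * pct f ∸ 5
  ; hi      = 10 * pct f + 5
  ; den     = 100000
  ; lo≤den  = from-yes (∀-fermion? λ f → 10 * pct f ∸ 5 ≤? 100000) f
  ; den≢0   = _
  ; columns = from-yes (∀-fermion? λ f → ∀-fermion? λ g →
                between? (10 * pct f ∸ 5) (10 * pct f + 5) 100000
                         (number f (evolve^ 147 (unit g))) (total (evolve^ 147 (unit g)))) f
  }

column-length : ∀ k g → length (decomp k [ fer g ]) ≡ total (evolve^ k (unit g))
column-length k g = trans (length-census (decomp-fermionic k ((g , refl) ∷ []))) (cong total (census-decomp k g))

column-count : ∀ k f g → count f (decomp k [ fer g ]) ≡ number f (evolve^ k (unit g))
column-count k f g = trans (sym (number-census f (decomp k [ fer g ]))) (cong (number f) (census-decomp k g))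

-- A fermion contributes a column of M^k; a non-fermion contributes at most 2^k particles, which
-- the term 2^k * nonFermions absorbs.
module _ {f k} (enc : Enclosure f k) where
  open Enclosure enc

  private
    defect : List Particle → ℕ
    defect xs = 2 ^ k * nonFermions xs

    nonFermion-length : ∀ {x} → nonFermions [ x ] ≡ 1 → length (decomp k [ x ]) ≤ defect [ x ]
    nonFermion-length {x} nf = subst (λ n → length (decomp k [ x ]) ≤ 2 ^ k * n) (sym nf) (length-decomp k [ x ])

    lower-single : ∀ x → lo * length (decomp k [ x ]) ≤ den * (count f (decomp k [ x ]) + defect [ x ])
    lower-single x with kind x
    ... | fermion g = begin
      lo * length (decomp k [ fer g ])      ≡⟨ cong (lo *_) (column-length k g) ⟩
      lo * total (evolve^ k (unit g))       ≤⟨ Between.lower (columns g) ⟩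
      den * number f (evolve^ k (unit g))   ≡⟨ cong (den *_) (column-count k f g) ⟨
      den * count f (decomp k [ fer g ])    ≤⟨ *-monoʳ-≤ den (m≤m+n _ (defect [ fer g ])) ⟩
      den * (count f (decomp k [ fer g ]) + defect [ fer g ]) ∎
      where open ≤-Reasoning
    ... | nonFermion nf _ = begin
      lo * length (decomp k [ x ])          ≤⟨ *-monoˡ-≤ _ lo≤den ⟩
      den * length (decomp k [ x ])         ≤⟨ *-monoʳ-≤ den (nonFermion-length nf) ⟩
      den * defect [ x ]                    ≤⟨ *-monoʳ-≤ den (m≤n+m _ _) ⟩
      den * (count f (decomp k [ x ]) + defect [ x ]) ∎
      where open ≤-Reasoning

    upper-single : ∀ x → den * count f (decomp k [ x ]) ≤ hi * length (decomp k [ x ]) + den * defect [ x ]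
    upper-single x with kind x
    ... | fermion g = begin
      den * count f (decomp k [ fer g ])    ≡⟨ cong (den *_) (column-count k f g) ⟩
      den * number f (evolve^ k (unit g))   ≤⟨ Between.upper (columns g) ⟩
      hi * total (evolve^ k (unit g))       ≡⟨ cong (hi *_) (column-length k g) ⟨
      hi * length (decomp k [ fer g ])      ≤⟨ m≤m+n _ _ ⟩
      hi * length (decomp k [ fer g ]) + den * defect [ fer g ] ∎
      where open ≤-Reasoning
    ... | nonFermion nf _ = begin
      den * count f (decomp k [ x ])        ≤⟨ *-monoʳ-≤ den (countB≤length (isThe f) (decomp k [ x ])) ⟩
      den * length (decomp k [ x ])         ≤⟨ *-monoʳ-≤ den (nonFermion-length nf) ⟩
      den * defect [ x ]                    ≤⟨ m≤n+m _ _ ⟩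
      hi * length (decomp k [ x ]) + den * defect [ x ] ∎
      where open ≤-Reasoning

    decomp-count-additive : Additive (count f ∘ decomp k)
    decomp-count-additive = decomp-additive k (countB-additive (isThe f))

    decomp-length-additive : Additive (length ∘ decomp k)
    decomp-length-additive = decomp-additive k length-additive

    defect-additive : Additive defect
    defect-additive = *-additive (2 ^ k) (countB-additive isNonFermion)

  enclosure-lower : ∀ xs → lo * length (decomp k xs) ≤ den * (count f (decomp k xs) + 2 ^ k * nonFermions xs)
  enclosure-lower = additive-≤ (*-additive lo decomp-length-additive)
                               (*-additive den (+-additive decomp-count-additive defect-additive)) lower-single

  enclosure-upper : ∀ xs → den * count f (decomp k xs) ≤ hi * length (decomp k xs) + den * (2 ^ k * nonFermions xs)
  enclosure-upper = additive-≤ (*-additive den decomp-count-additive)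
                               (+-additive (*-additive hi decomp-length-additive) (*-additive den defect-additive))
                               upper-single

bernoulli : ∀ w m → w ^ m * (w + m) ≤ w * suc w ^ m
bernoulli w zero    = ≤-reflexive (trans (+-identityʳ (w + 0)) (trans (+-identityʳ w) (sym (*-identityʳ w))))
bernoulli w (suc m) = begin
  w * w ^ m * (w + suc m)              ≡⟨ expand w (w ^ m) m ⟩
  w * (w ^ m * (w + m)) + w * w ^ m    ≤⟨ +-mono-≤ (*-monoʳ-≤ w (bernoulli w m)) (*-monoʳ-≤ w (^-monoˡ-≤ m (n≤1+n w))) ⟩
  w * (w * suc w ^ m) + w * suc w ^ m  ≡⟨ collect w (suc w ^ m) ⟩
  w * (suc w * suc w ^ m)              ∎
  where
    open ≤-Reasoning
    expand : ∀ w X m → w * X * (w + suc m) ≡ w * (X * (w + m)) + w * X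
    expand = solve-∀
    collect : ∀ w Y → w * (w * Y) + w * Y ≡ w * (suc w * Y)
    collect = solve-∀

geometric-decay : ∀ w q .{{_ : NonZero w}} → w ^ (w * q) * q ≤ suc w ^ (w * q)
geometric-decay w q = *-cancelˡ-≤ w (begin
  w * (w ^ m * q)    ≡⟨ reassociate w (w ^ m) q ⟩
  w ^ m * m          ≤⟨ *-monoʳ-≤ (w ^ m) (m≤n+m m w) ⟩
  w ^ m * (w + m)    ≤⟨ bernoulli w m ⟩
  w * suc w ^ m      ∎)
  where
    open ≤-Reasoning
    m : ℕ
    m = w * q
    reassociate : ∀ w X q → w * (X * q) ≡ X * (w * q)
    reassociate = solve-∀

-- Rational bounds

toℚᵘ-ratio : ∀ a b .{{_ : NonZero b}} → toℚᵘ (ratio a b) ℚᵘ.≃ ℚᵘ.mkℚᵘ (ℤ.+ a) (pred b)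
toℚᵘ-ratio a (suc b) = ℚ.toℚᵘ-fromℚᵘ (ℚᵘ.mkℚᵘ (ℤ.+ a) b)

ratio-mono-≤ : ∀ a b c d .{{_ : NonZero b}} .{{_ : NonZero d}} → a * d ≤ c * b → ratio a b ℚ.≤ ratio c d
ratio-mono-≤ a b@(suc _) c d@(suc _) h =
  ℚ.toℚᵘ-cancel-≤ (ℚᵘ.≤-respˡ-≃ (ℚᵘ.≃-sym (toℚᵘ-ratio a b)) (ℚᵘ.≤-respʳ-≃ (ℚᵘ.≃-sym (toℚᵘ-ratio c d))
    (ℚᵘ.*≤* (subst₂ ℤ._≤_ (ℤ.pos-* a d) (ℤ.pos-* c b) (ℤ.+≤+ h)))))

ratio-mono-< : ∀ a b c d .{{_ : NonZero b}} .{{_ : NonZero d}} → a * d < c * b → ratio a b ℚ.< ratio c d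
ratio-mono-< a b@(suc _) c d@(suc _) h =
  ℚ.toℚᵘ-cancel-< (ℚᵘ.<-respˡ-≃ (ℚᵘ.≃-sym (toℚᵘ-ratio a b)) (ℚᵘ.<-respʳ-≃ (ℚᵘ.≃-sym (toℚᵘ-ratio c d))
    (ℚᵘ.*<* (subst₂ ℤ._<_ (ℤ.pos-* a d) (ℤ.pos-* c b) (ℤ.+<+ h)))))

ratio-+ : ∀ a b c d .{{_ : NonZero b}} .{{_ : NonZero d}} →
          ratio a b ℚ.+ ratio c d ≡ ratio (a * d + c * b) (b * d)
ratio-+ a b@(suc b′) c d@(suc d′) = ℚ.toℚᵘ-injective
  (ℚᵘ.≃-trans (ℚ.toℚᵘ-homo-+ (ratio a b) (ratio c d))
  (ℚᵘ.≃-trans (ℚᵘ.+-cong (toℚᵘ-ratio a b) (toℚᵘ-ratio c d))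
  (ℚᵘ.≃-trans (ℚᵘ.≃-reflexive (cong (λ z → ℚᵘ.mkℚᵘ z (d′ + b′ * d)) numerator))
              (ℚᵘ.≃-sym (toℚᵘ-ratio (a * d + c * b) (b * d))))))
  where
    numerator : ℤ.+ a ℤ.* ℤ.+ d ℤ.+ ℤ.+ c ℤ.* ℤ.+ b ≡ ℤ.+ (a * d + c * b)
    numerator = trans (cong₂ ℤ._+_ (sym (ℤ.pos-* a d)) (sym (ℤ.pos-* c b))) (sym (ℤ.pos-+ (a * d) (c * b)))

ratio-nonNegative : ∀ a b → ℚ.0ℚ ℚ.≤ ratio a b
ratio-nonNegative a zero    = ℚ.≤-refl
ratio-nonNegative a (suc b) = ℚ.nonNegative⁻¹ (ratio a (suc b)) {{ℚ.normalize-nonNeg a (suc b)}}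

positive⇒ratio : ∀ ε → ℚ.Positive ε → ∃₂ λ p q → ε ≡ ratio (suc p) (suc q)
positive⇒ratio (mkℚ ℤ.+[1+ p ] q c) _ = p , q , sym (ℚ.↥p/↧p≡p (mkℚ ℤ.+[1+ p ] q c))

<-+⇒-< : ∀ {x y ε} → x ℚ.< y ℚ.+ ε → x ℚ.- ε ℚ.< y
<-+⇒-< {x} {y} {ε} h = subst (x ℚ.- ε ℚ.<_) (cancel y ε) (ℚ.+-monoˡ-< (ℚ.- ε) h)
  where
    open +-*-Solver
    cancel : ∀ y ε → y ℚ.+ ε ℚ.- ε ≡ y
    cancel = solve 2 (λ y ε → y :+ ε :- ε := y) refl

∣-∣<-interval : ∀ {a b x y} → a ℚ.< x → x ℚ.< b → a ℚ.< y → y ℚ.< b → ℚ.∣ x ℚ.- y ∣ ℚ.< b ℚ.- a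
∣-∣<-interval {a} {b} {x} {y} a<x x<b a<y y<b with ℚ.∣p∣≡p∨∣p∣≡-p (x ℚ.- y)
... | inj₁ ∣x-y∣≡x-y  = subst (ℚ._< b ℚ.- a) (sym ∣x-y∣≡x-y) (ℚ.+-mono-< x<b (ℚ.neg-antimono-< a<y))
... | inj₂ ∣x-y∣≡y-x  = subst (ℚ._< b ℚ.- a) (sym (trans ∣x-y∣≡y-x (flip x y)))
                              (ℚ.+-mono-< y<b (ℚ.neg-antimono-< a<x))
  where
    open +-*-Solver
    flip : ∀ x y → ℚ.- (x ℚ.- y) ≡ y ℚ.- x
    flip = solve 2 (λ x y → :- (x :- y) := y :- x) refl

thirds : ∀ p q → let η = ratio (suc p) (3 * suc q) in η ℚ.+ (η ℚ.+ η) ℚ.≤ ratio (suc p) (suc q)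
thirds p q = begin
  ratio a b ℚ.+ (ratio a b ℚ.+ ratio a b)       ≡⟨ cong (ratio a b ℚ.+_) (ratio-+ a b a b) ⟩
  ratio a b ℚ.+ ratio (a * b + a * b) (b * b)   ≡⟨ ratio-+ a b (a * b + a * b) (b * b) ⟩
  ratio (a * (b * b) + (a * b + a * b) * b) (b * (b * b))
                                               ≤⟨ ratio-mono-≤ (a * (b * b) + (a * b + a * b) * b) (b * (b * b)) a (suc q)
                                                   (≤-reflexive (cross-multiplied a q)) ⟩
  ratio a (suc q)                              ∎
  where
    open ℚ.≤-Reasoning
    a b : ℕ
    a = suc p
    b = 3 * suc q
    cross-multiplied : ∀ a q →
      (a * (3 * suc q * (3 * suc q)) + (a * (3 * suc q) + a * (3 * suc q)) * (3 * suc q)) * suc q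
      ≡ a * (3 * suc q * (3 * suc q * (3 * suc q)))
    cross-multiplied = solve-∀

squeezed⇒close : ∀ {L H η x y} → H ℚ.≤ L ℚ.+ η →
                  L ℚ.- η ℚ.< x × x ℚ.< H ℚ.+ η → L ℚ.- η ℚ.< y × y ℚ.< H ℚ.+ η →
                  ℚ.∣ x ℚ.- y ∣ ℚ.< η ℚ.+ (η ℚ.+ η)
squeezed⇒close {L} {H} {η} H≤L+η (L-η<x , x<H+η) (L-η<y , y<H+η) =
  ℚ.<-≤-trans (∣-∣<-interval {L ℚ.- η} {H ℚ.+ η} L-η<x x<H+η L-η<y y<H+η) (begin
    H ℚ.+ η ℚ.- (L ℚ.- η)       ≤⟨ ℚ.+-monoˡ-≤ (ℚ.- (L ℚ.- η)) (ℚ.+-monoˡ-≤ η H≤L+η) ⟩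
    L ℚ.+ η ℚ.+ η ℚ.- (L ℚ.- η) ≡⟨ collect L η ⟩
    η ℚ.+ (η ℚ.+ η)             ∎)
  where
    open ℚ.≤-Reasoning
    open +-*-Solver
    collect : ∀ L η → L ℚ.+ η ℚ.+ η ℚ.- (L ℚ.- η) ≡ η ℚ.+ (η ℚ.+ η)
    collect = solve 2 (λ L η → L :+ η :+ η :- (L :- η) := η :+ (η :+ η)) refl

converges-if-squeezed : ∀ (u : ℕ → ℚ) →
  (∀ η → ℚ.Positive η → ∃₂ λ L H → H ℚ.≤ L ℚ.+ η × Eventually (λ n → L ℚ.- η ℚ.< u n × u n ℚ.< H ℚ.+ η)) →
  Converges u
converges-if-squeezed u squeeze ε ε>0 with positive⇒ratio ε ε>0
... | p , q , refl =
  let L , H , H≤L+η , N , within = squeeze η (ℚ.normalize-pos (suc p) (3 * suc q)) in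
  N , λ m n N≤m N≤n → ℚ.<-≤-trans (squeezed⇒close {L} {H} H≤L+η (within m N≤m) (within n N≤n)) (thirds p q)
  where
    η : ℚ
    η = ratio (suc p) (3 * suc q)

∣ratio∣< : ∀ {c l p q} → c * suc q < suc p * l → ℚ.∣ ratio c l ∣ ℚ.< ratio (suc p) (suc q)
∣ratio∣< {c} {zero}  {p} {q} h = contradiction (subst (c * suc q <_) (*-zeroʳ (suc p)) h) n≮0
∣ratio∣< {c} {suc l} {p} {q} h =
  subst (ℚ._< ratio (suc p) (suc q)) (sym (ℚ.0≤p⇒∣p∣≡p (ratio-nonNegative c (suc l))))
        (ratio-mono-< c (suc l) (suc p) (suc q) h)

ratio-within : ∀ {lo hi den c l δ p q} .{{_ : NonZero den}} →
  lo * l ≤ den * (c + δ) → den * c ≤ hi * l + den * δ → δ * suc q < suc p * l →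
  ratio lo den ℚ.- ratio (suc p) (suc q) ℚ.< ratio c l × ratio c l ℚ.< ratio hi den ℚ.+ ratio (suc p) (suc q)
ratio-within {l = zero} {δ} {p} {q} _ _ small = contradiction (subst (δ * suc q <_) (*-zeroʳ (suc p)) small) n≮0
ratio-within {lo} {hi} {den} {c} {l@(suc _)} {δ} {p} {q} lower upper small = <-+⇒-< lower′ , upper′
  where
    open ℚ.≤-Reasoning
    ε : ℚ
    ε = ratio (suc p) (suc q)
    instance
      den*l≢0 : NonZero (den * l)
      den*l≢0 = m*n≢0 den l
    δ/l<ε : ratio δ l ℚ.< ε
    δ/l<ε = ratio-mono-< δ l (suc p) (suc q) small
    lower-cross : lo * (l * l) ≤ (c * l + δ * l) * den
    lower-cross = subst₂ _≤_ (*-assoc lo l l) (regroup den c δ l) (*-monoˡ-≤ l lower)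
      where
        regroup : ∀ den c δ l → den * (c + δ) * l ≡ (c * l + δ * l) * den
        regroup = solve-∀
    upper-cross : c * (den * l) ≤ (hi * l + δ * den) * l
    upper-cross = subst₂ _≤_ (regroup den c l) (cong (λ x → (hi * l + x) * l) (*-comm den δ)) (*-monoˡ-≤ l upper)
      where
        regroup : ∀ den c l → den * c * l ≡ c * (den * l)
        regroup = solve-∀
    lower′ : ratio lo den ℚ.< ratio c l ℚ.+ ε
    lower′ = begin-strict
      ratio lo den                       ≤⟨ ratio-mono-≤ lo den (c * l + δ * l) (l * l) lower-cross ⟩
      ratio (c * l + δ * l) (l * l)      ≡⟨ ratio-+ c l δ l ⟨
      ratio c l ℚ.+ ratio δ l            <⟨ ℚ.+-monoʳ-< (ratio c l) δ/l<ε ⟩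
      ratio c l ℚ.+ ε                    ∎
    upper′ : ratio c l ℚ.< ratio hi den ℚ.+ ε
    upper′ = begin-strict
      ratio c l                          ≤⟨ ratio-mono-≤ c l (hi * l + δ * den) (den * l) upper-cross ⟩
      ratio (hi * l + δ * den) (den * l) ≡⟨ ratio-+ hi den δ l ⟨
      ratio hi den ℚ.+ ratio δ l         <⟨ ℚ.+-monoʳ-< (ratio hi den) δ/l<ε ⟩
      ratio hi den ℚ.+ ε                 ∎

enclosure-narrow : ∀ {f k} m (enc : Enclosure f k) → Width m enc → let open Enclosure enc in
  ∀ p q → 16 ^ m * suc q ≤ suc p * 17 ^ m → ratio hi den ℚ.≤ ratio lo den ℚ.+ ratio (suc p) (suc q)
enclosure-narrow {f} {k} m enc width p q decay =
  subst (ratio hi den ℚ.≤_) (sym (ratio-+ lo den (suc p) (suc q) {{den≢0}}))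
        (ratio-mono-≤ hi den (lo * suc q + suc p * den) (den * suc q) {{den≢0}} {{m*n≢0 den (suc q) {{den≢0}}}}
                      (subst (_≤ (lo * suc q + suc p * den) * den) (rearrange hi (suc q) den)
                             (*-monoˡ-≤ den narrow)))
  where
    open Enclosure enc
    open ≤-Reasoning
    rearrange : ∀ hi Q den → hi * Q * den ≡ hi * (den * Q)
    rearrange = solve-∀
    narrow : hi * suc q ≤ lo * suc q + suc p * den
    narrow = *-cancelˡ-≤ (17 ^ m) {{m^n≢0 17 m}} (begin
      17 ^ m * (hi * suc q)                              ≡⟨ *-assoc (17 ^ m) hi (suc q) ⟨
      17 ^ m * hi * suc q                                ≤⟨ *-monoˡ-≤ (suc q) width ⟩
      (17 ^ m * lo + 16 ^ m * den) * suc q               ≡⟨ spread (17 ^ m) lo (16 ^ m) den (suc q) ⟩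
      17 ^ m * (lo * suc q) + 16 ^ m * suc q * den       ≤⟨ +-monoʳ-≤ (17 ^ m * (lo * suc q)) (*-monoˡ-≤ den decay) ⟩
      17 ^ m * (lo * suc q) + suc p * 17 ^ m * den       ≡⟨ gather (17 ^ m) lo (suc q) (suc p) den ⟩
      17 ^ m * (lo * suc q + suc p * den)                ∎)
      where
        spread : ∀ X lo Y den Q → (X * lo + Y * den) * Q ≡ X * (lo * Q) + Y * Q * den
        spread = solve-∀
        gather : ∀ X lo Q P den → X * (lo * Q) + P * X * den ≡ X * (lo * Q + P * den)
        gather = solve-∀

module Evolution (ps : List Particle) (start : 1 ≤ fermions (decomp 4 ps)) where

  length-superlinear : ∀ a → Eventually (λ n → a * suc n < length (decomp n ps))
  length-superlinear a =
    eventually-mono (λ {n} h → <-≤-trans h (countB≤length isFermion (decomp n ps))) (linear<g a)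
    where
      double : ∀ n → 2 * fermions (decomp n ps) ≤ fermions (decomp (14 + n) ps)
      double n = subst (λ xs → 2 * fermions (decomp n ps) ≤ fermions xs) (sym (decomp-+ 14 n ps))
                       (fermions-double (decomp n ps))
      open Doubling (λ n → fermions (decomp n ps)) (λ n → fermions-mono (decomp n ps)) 14 double 4 start

  linear-negligible : ∀ (φ : ℕ → ℕ) a → (∀ n → φ n ≤ a * suc n) →
                      ∀ p q → Eventually (λ n → φ n * suc q < suc p * length (decomp n ps))
  linear-negligible φ a φ≤ p q = eventually-mono bound (length-superlinear (a * suc q))
    where
      bound : ∀ {n} → a * suc q * suc n < length (decomp n ps) → φ n * suc q < suc p * length (decomp n ps)
      bound {n} h = begin-strict
        φ n * suc q          ≤⟨ *-monoˡ-≤ (suc q) (φ≤ n) ⟩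
        a * suc n * suc q    ≡⟨ swap a (suc n) (suc q) ⟩
        a * suc q * suc n    <⟨ h ⟩
        length (decomp n ps) ≤⟨ m≤m+n _ _ ⟩
        suc p * length (decomp n ps) ∎
        where
          open ≤-Reasoning
          swap : ∀ a n q → a * n * q ≡ a * q * n
          swap = solve-∀

  nonFermion-proportion→0 : TendsToZero (λ n → proportion isNonFermion (decomp n ps))
  nonFermion-proportion→0 ε ε>0 with positive⇒ratio ε ε>0
  ... | p , q , refl =
    eventually-mono (λ {n} → ∣ratio∣< {nonFermions (decomp n ps)} {length (decomp n ps)} {p} {q})
      (linear-negligible (λ n → nonFermions (decomp n ps)) (nonFermions ps)
                         (λ n → ≤-trans (nonFermions-decomp n ps) (≤-reflexive (*-comm (suc n) (nonFermions ps)))) p q)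

  -- decomp n ps is decomp k (decomp (n ∸ k) ps), whose non-fermions are linearly many while the
  -- length grows exponentially.
  proportion-enclosed : ∀ {f k} (enc : Enclosure f k) → let open Enclosure enc in
    ∀ ε → ℚ.Positive ε → Eventually (λ n → ratio lo den ℚ.- ε ℚ.< proportion (isThe f) (decomp n ps)
                                           × proportion (isThe f) (decomp n ps) ℚ.< ratio hi den ℚ.+ ε)
  proportion-enclosed {f} {k} enc ε ε>0 with positive⇒ratio ε ε>0
  ... | p , q , refl =
    eventually-mono enclosed (eventually-≥ k (linear-negligible defect (2 ^ k * nonFermions ps) defect≤ p q))
    where
      open Enclosure enc

      Enclosed : List Particle → Set
      Enclosed xs = ratio lo den ℚ.- ratio (suc p) (suc q) ℚ.< proportion (isThe f) xs
                  × proportion (isThe f) xs ℚ.< ratio hi den ℚ.+ ratio (suc p) (suc q)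

      defect : ℕ → ℕ
      defect n = 2 ^ k * nonFermions (decomp (n ∸ k) ps)

      defect≤ : ∀ n → defect n ≤ 2 ^ k * nonFermions ps * suc n
      defect≤ n = begin
        2 ^ k * nonFermions (decomp (n ∸ k) ps)  ≤⟨ *-monoʳ-≤ (2 ^ k) (nonFermions-decomp (n ∸ k) ps) ⟩
        2 ^ k * (suc (n ∸ k) * nonFermions ps)   ≤⟨ *-monoʳ-≤ (2 ^ k) (*-monoˡ-≤ (nonFermions ps) (s≤s (m∸n≤m n k))) ⟩
        2 ^ k * (suc n * nonFermions ps)         ≡⟨ swap (2 ^ k) (suc n) (nonFermions ps) ⟩
        2 ^ k * nonFermions ps * suc n           ∎
        where
          open ≤-Reasoning
          swap : ∀ a n b → a * (n * b) ≡ a * b * n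
          swap = solve-∀

      enclosed : ∀ {n} → k ≤ n × defect n * suc q < suc p * length (decomp n ps) → Enclosed (decomp n ps)
      enclosed {n} (k≤n , small) =
        subst Enclosed split
          (ratio-within {lo} {hi} {den} {count f (decomp k L)} {length (decomp k L)} {defect n} {p} {q} {{den≢0}}
                        (enclosure-lower enc L) (enclosure-upper enc L)
                        (subst (λ xs → defect n * suc q < suc p * length xs) (sym split) small))
        where
          L : List Particle
          L = decomp (n ∸ k) ps
          split : decomp k L ≡ decomp n ps
          split = trans (sym (decomp-+ k (n ∸ k) ps)) (cong (λ j → decomp j ps) (m+[n∸m]≡n k≤n))

  proportion-converges : ∀ f → Converges (λ n → proportion (isThe f) (decomp n ps))
  proportion-converges f = converges-if-squeezed _ squeeze
    where
      Squeezed : ℚ → Set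
      Squeezed η = ∃₂ λ L H → H ℚ.≤ L ℚ.+ η
                   × Eventually (λ n → L ℚ.- η ℚ.< proportion (isThe f) (decomp n ps)
                                     × proportion (isThe f) (decomp n ps) ℚ.< H ℚ.+ η)

      squeeze-by : ∀ p q {k} (enc : Enclosure f k) → Width (16 * suc q) enc →
                   ℚ.Positive (ratio (suc p) (suc q)) → Squeezed (ratio (suc p) (suc q))
      squeeze-by p q enc width η>0 =
        ratio lo den , ratio hi den , enclosure-narrow (16 * suc q) enc width p q decay ,
        proportion-enclosed enc (ratio (suc p) (suc q)) η>0
        where
          open Enclosure enc
          decay : 16 ^ (16 * suc q) * suc q ≤ suc p * 17 ^ (16 * suc q)
          decay = ≤-trans (geometric-decay 16 (suc q)) (m≤m+n _ _)

      squeeze : ∀ η → ℚ.Positive η → Squeezed η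
      squeeze η η>0 with positive⇒ratio η η>0
      ... | p , q , refl = let k , enc , width = enclosures f (16 * suc q) in squeeze-by p q enc width η>0

mainTheorem4 : (A : Str) →
    ¬ (∃ λ n → ∃ λ (qs : List Particle) → All IsNeutrino qs × Splits (iter n A) (map str qs)) →
    (N : ℕ) (ps : List Particle) → Splits (iter N A) (map str ps) →
    TendsToZero (λ k → proportion isNonFermion (decomp k ps))
    × ((f : Fermion) →
         Converges (λ k → proportion (isThe f) (decomp k ps))
         × LimitIn (λ k → proportion (isThe f) (decomp k ps)) (lowerBound f) (upperBound f))
mainTheorem4 A no-neutrino-splitting N ps splits =
  nonFermion-proportion→0 , λ f → proportion-converges f , proportion-enclosed (decimal-enclosure f)
  where
    open Evolution ps (fermions-within-4 ps (λ all-ν → no-neutrino-splitting (N , ps , all-ν , splits)))
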